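{- Let $k\ge1$, $n\ge2$ and $T'\in\mathcal T^k_{n-1}$ with bottom row entries $b'_1<\dots<b'_{n-1}$. Then the number of $T\in\mathcal T^k_n$ with $\mathrm{red}(T)=T'$ equals $b'_1$ (the last entry of the first column of $T'$). Moreover, if $b_1<\dots<b_n$ are the bottom row entries of such a $T$, then $b_j=b'_{j-1}+k+1$ for $2\le j\le n$, and $b_1$ can be any one of the $b'_1$ numbers $k+1,k+2,\dots,k+b'_1$ (each choice giving exactly one such $T$).
   Context: $\mathcal T^k_n$ is the set of arrays with $k+1$ rows and $n$ columns containing each of $1,\dots,(k+1)n$ once, increasing along rows and down columns, such that whenever $a<b<c<d$ with $d$ immediately below $a$, the entries $b$ and $c$ are not in the same column. The bottom row is row $k+1$. For $T\in\mathcal T^k_n$, $\mathrm{red}(T)$ is obtained by deleting the first column of $T$ and replacing the remaining entries by $1,\dots,(k+1)(n-1)$ in an order-preserving way. -}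

module Defs where

open import Data.Nat using (ℕ; zero; suc; _+_; _*_; _≤_; _<_; _≤?_)
open import Data.Fin as Fin using (Fin; inject₁)
open import Data.Vec using (Vec; []; _∷_; lookup; map; toList)
open import Data.List as List using (List; concat; filter; length)
open import Data.Product using (Σ; _×_; ∃-syntax)
open import Data.Empty using (⊥)
open import Relation.Binary.PropositionalEquality using (_≡_)

-- An array with k+1 rows and n columns of natural numbers (row-major).
-- Rows are indexed by Fin (suc k) (row 0 is the top row, row k the bottom
-- row), columns by Fin n.
Array : ℕ → ℕ → Set
Array k n = Vec (Vec ℕ n) (suc k)

entry : ∀ {k n} → Array k n → Fin (suc k) → Fin n → ℕ
entry T i j = lookup (lookup T i) j

record IsT (k n : ℕ) (T : Array k n) : Set where
  field
    inRange   : ∀ i j → 1 ≤ entry T i j × entry T i j ≤ suc k * n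
    covers    : ∀ v → 1 ≤ v → v ≤ suc k * n → ∃[ i ] ∃[ j ] entry T i j ≡ v
    injective : ∀ i j i' j' → entry T i j ≡ entry T i' j' → i ≡ i' × j ≡ j'
    rowInc    : ∀ i (j j' : Fin n) → j Fin.< j' → entry T i j < entry T i j'
    colInc    : ∀ (i i' : Fin (suc k)) j → i Fin.< i' → entry T i j < entry T i' j
    avoids    : ∀ (i : Fin k) j i₁ i₂ j' →
                entry T (inject₁ i) j < entry T i₁ j' →
                entry T i₁ j' < entry T i₂ j' →
                entry T i₂ j' < entry T (Fin.suc i) j →
                ⊥

dropFirst : ∀ {A : Set} {n} → Vec A (suc n) → Vec A n
dropFirst (_ ∷ xs) = xs

red : ∀ {k n} → Array k (suc n) → Array k n
red T = map (map rank) rest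
  where
    rest = map dropFirst T
    entries : List ℕ
    entries = concat (toList (map toList rest))
    rank : ℕ → ℕ
    rank x = length (filter (_≤? x) entries)

-- Deleting the first column of T and standardizing gives T', so T is determined by T' together with the
-- ranks q₀ ≤ … ≤ q_k of its first-column entries among the remaining ones: row i starts with q_i + i + 1,
-- and an entry x of T' becomes x + #{i | q_i < x}. The pattern condition forces q_i = rankAbove q_{i+1},
-- where rankAbove q is the largest entry of T' whose lower neighbour is at most q, so T is determined by
-- q_k, which must be smaller than b₁'. Conversely, for every q_k < b₁' these formulas give an array of
-- 𝒯^k_n: avoidance in T' is exactly what keeps rankAbove below the first column, and the maximality of
-- rankAbove is what prevents new patterns. The bottom row of T then starts with q_k + k + 1 and every other
-- bottom entry is shifted by k + 1, since all first-column entries are smaller.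

module Submission where

open import Defs
open import Data.Empty using (⊥; ⊥-elim)
open import Data.Fin as Fin using (Fin; zero; suc; toℕ; inject₁; fromℕ; fromℕ<; lower₁)
open import Data.Fin.Induction using (<-weakInduction-startingFrom; >-weakInduction)
open import Data.Fin.Properties
  using (toℕ-injective; toℕ-inject₁; toℕ-fromℕ; toℕ-fromℕ<; toℕ<n; toℕ≤pred[n]; inject₁-lower₁; ≤fromℕ; inject₁-injective; any?)
  renaming (suc-injective to Fin-suc-injective; 0≢1+n to Fin-0≢1+n)
open import Data.List as List using (List; []; _∷_; _++_; filter; length; tabulate)
open import Data.List.Membership.Propositional using (_∈_)
open import Data.List.Membership.Propositional.Properties using (∈-++⁺ˡ; ∈-++⁺ʳ; ∈-++⁻; ∈-tabulate⁺; ∈-tabulate⁻)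
open import Data.List.Properties
  using (filter-++; length-++; length-filter; filter-all; filter-none; filter-accept; filter-reject; length-tabulate; map-++)
open import Data.List.Relation.Unary.All as All using (All; []; _∷_)
open import Data.List.Relation.Unary.All.Properties using (tabulate⁺)
open import Data.List.Relation.Unary.AllPairs using ([]; _∷_)
open import Data.List.Relation.Unary.Any using (here; there)
open import Data.List.Relation.Unary.Unique.Propositional using (Unique)
import Data.List.Relation.Unary.Unique.Propositional.Properties as Unique
open import Data.Nat using (ℕ; zero; suc; _+_; _*_; _∸_; _⊔_; _≤_; _<_; _≤?_; _<?_; _≟_; z≤n; s≤s; s≤s⁻¹)
open import Data.Nat.GeneralisedArithmetic using (fold)
open import Data.Nat.Properties
open import Algebra.Properties.CommutativeSemigroup +-commutativeSemigroup using () renaming (interchange to +-interchange)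
open import Data.Product as Product using (Σ; _×_; _,_; proj₁; proj₂; ∃; ∃₂)
open import Data.Sum as Sum using (_⊎_; inj₁; inj₂; [_,_])
open import Data.Vec as Vec using (Vec; []; _∷_; lookup; toList; last; head)
open import Data.Vec.Properties using (toList-map; lookup-map; lookup∘tabulate; tabulate∘lookup; tabulate-cong)
open import Function using (_∘_)
open import Function.Bundles using (_⇔_; mk⇔; Equivalence)
open import Level using (0ℓ)
open import Relation.Binary.Definitions using (Monotonic₁; tri<; tri≈; tri>)
open import Relation.Binary.PropositionalEquality
  using (_≡_; _≢_; refl; sym; trans; cong; cong₂; subst; subst₂; module ≡-Reasoning)
open import Relation.Nullary using (¬_; Dec; yes; no)
open import Relation.Unary using (Pred; Decidable; ∁)

m∸n≡1+[m∸1+n] : ∀ {m n} → n < m → m ∸ n ≡ suc (m ∸ suc n)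
m∸n≡1+[m∸1+n] {suc m} {zero}  _         = refl
m∸n≡1+[m∸1+n] {suc m} {suc n} (s≤s n<m) = m∸n≡1+[m∸1+n] n<m

suc[n+k]-range : ∀ {n b} k → n < b → suc k ≤ suc (n + k) × suc (n + k) ≤ k + b
suc[n+k]-range {n} {b} k n<b = s≤s (m≤n+m k n) , subst (suc (n + k) ≤_) (+-comm b k) (+-monoˡ-≤ k n<b)

suc[n+k]-range⁻¹ : ∀ {c b} k → suc k ≤ c → c ≤ k + b → c ∸ suc k < b × suc (c ∸ suc k + k) ≡ c
suc[n+k]-range⁻¹ {c} {b} k 1+k≤c c≤k+b = +-cancelʳ-≤ k (suc (c ∸ suc k)) b (subst₂ _≤_ (sym c≡) (+-comm k b) c≤k+b) , c≡
  where
  c≡ : suc (c ∸ suc k + k) ≡ c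
  c≡ = trans (sym (+-suc (c ∸ suc k) k)) (m∸n+n≡m 1+k≤c)

inject₁<suc : ∀ {n} (i : Fin n) → inject₁ i Fin.< suc i
inject₁<suc i = ≤-reflexive (cong suc (toℕ-inject₁ i))

predIndex : ∀ {n t} → t ≤ n → 0 < t → Σ (Fin n) λ j → suc (toℕ j) ≡ t
predIndex {t = suc _} t≤n _ = fromℕ< t≤n , cong suc (toℕ-fromℕ< t≤n)

<⇒inject₁ : ∀ {n} {i j : Fin (suc n)} → i Fin.< j → ∃ λ i₀ → inject₁ i₀ ≡ i
<⇒inject₁ {n} {i} {j} i<j = lower₁ i n≢i , inject₁-lower₁ i n≢i
  where
  n≢i : n ≢ toℕ i
  n≢i n≡i = <-irrefl (sym n≡i) (<-≤-trans i<j (toℕ≤pred[n] j))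

stepwise-monotone : ∀ {n} (f : Fin (suc n) → ℕ) → (∀ j → f (inject₁ j) ≤ f (suc j)) → Monotonic₁ Fin._≤_ _≤_ f
stepwise-monotone f step {i} i≤j = <-weakInduction-startingFrom (λ j → f i ≤ f j) ≤-refl (λ j fi≤ → ≤-trans fi≤ (step j)) i≤j

module StrictlyIncreasing {A : Set} (ι : A → ℕ) (ι-injective : ∀ {x y} → ι x ≡ ι y → x ≡ y)
                          {f : A → ℕ} (f-strict : ∀ {x y} → ι x < ι y → f x < f y) where

  monotone : ∀ {x y} → ι x ≤ ι y → f x ≤ f y
  monotone ιx≤ιy with m≤n⇒m<n∨m≡n ιx≤ιy
  ... | inj₁ ιx<ιy = <⇒≤ (f-strict ιx<ιy)
  ... | inj₂ ιx≡ιy = ≤-reflexive (cong f (ι-injective ιx≡ιy))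

  reflects-< : ∀ {x y} → f x < f y → ι x < ι y
  reflects-< fx<fy = ≰⇒> (λ ιy≤ιx → <⇒≱ fx<fy (monotone ιy≤ιx))

  reflects-≤ : ∀ {x y} → f x ≤ f y → ι x ≤ ι y
  reflects-≤ fx≤fy = ≮⇒≥ (λ ιy<ιx → <⇒≱ (f-strict ιy<ιx) fx≤fy)

  injective : ∀ {x y} → f x ≡ f y → x ≡ y
  injective fx≡fy = ι-injective (≤-antisym (reflects-≤ (≤-reflexive fx≡fy)) (reflects-≤ (≤-reflexive (sym fx≡fy))))

max : ∀ {n} → (Fin n → ℕ) → ℕ
max {zero}  f = 0
max {suc n} f = f zero ⊔ max (f ∘ suc)

≤-max : ∀ {n} (f : Fin n → ℕ) i → f i ≤ max f
≤-max f zero    = m≤m⊔n _ _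
≤-max f (suc i) = ≤-trans (≤-max (f ∘ suc) i) (m≤n⊔m _ _)

max-attained : ∀ {n} (f : Fin n → ℕ) → max f ≡ 0 ⊎ ∃ λ i → max f ≡ f i
max-attained {zero}  f = inj₁ refl
max-attained {suc n} f with ≤-total (f zero) (max (f ∘ suc))
... | inj₂ f₀≥ = inj₂ (zero , m≥n⇒m⊔n≡m f₀≥)
... | inj₁ f₀≤ with max-attained (f ∘ suc)
...   | inj₁ max≡0      = inj₁ (trans (m≤n⇒m⊔n≡n f₀≤) max≡0)
...   | inj₂ (i , max≡) = inj₂ (suc i , trans (m≤n⇒m⊔n≡n f₀≤) max≡)

_onlyIf_ : {A : Set} → ℕ → Dec A → ℕ
x onlyIf yes _ = x
x onlyIf no _  = 0

onlyIf-yes : {A : Set} (x : ℕ) (a? : Dec A) → A → x onlyIf a? ≡ x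
onlyIf-yes x (yes _) _ = refl
onlyIf-yes x (no ¬a) a = ⊥-elim (¬a a)

onlyIf-cases : {A : Set} (x : ℕ) (a? : Dec A) → x onlyIf a? ≡ 0 ⊎ (A × x onlyIf a? ≡ x)
onlyIf-cases x (yes a) = inj₂ (a , refl)
onlyIf-cases x (no _)  = inj₁ refl

-- Counting in lists

count : {A : Set} {P : Pred A 0ℓ} → Decidable P → List A → ℕ
count P? xs = length (filter P? xs)

module _ {A : Set} {P : Pred A 0ℓ} (P? : Decidable P) where

  count-++ : ∀ xs ys → count P? (xs ++ ys) ≡ count P? xs + count P? ys
  count-++ xs ys = trans (cong length (filter-++ P? xs ys)) (length-++ (filter P? xs))

  count-all : ∀ {xs} → All P xs → count P? xs ≡ length xs
  count-all = cong length ∘ filter-all P?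

  count-none : ∀ {xs} → All (∁ P) xs → count P? xs ≡ 0
  count-none = cong length ∘ filter-none P?

  count-accept : ∀ {x xs} → P x → count P? (x ∷ xs) ≡ suc (count P? xs)
  count-accept = cong length ∘ filter-accept P?

  count-reject : ∀ {x xs} → ¬ P x → count P? (x ∷ xs) ≡ count P? xs
  count-reject = cong length ∘ filter-reject P?

module _ {A : Set} {P Q : Pred A 0ℓ} (P? : Decidable P) (Q? : Decidable Q) where

  count-mono : (∀ {x} → P x → Q x) → ∀ xs → count P? xs ≤ count Q? xs
  count-mono P⊆Q [] = z≤n
  count-mono P⊆Q (x ∷ xs) with P? x | Q? x
  ... | yes _  | yes _ = s≤s (count-mono P⊆Q xs)
  ... | yes px | no ¬qx = ⊥-elim (¬qx (P⊆Q px))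
  ... | no _   | yes _ = m≤n⇒m≤1+n (count-mono P⊆Q xs)
  ... | no _   | no _ = count-mono P⊆Q xs

  count-mono-< : (∀ {x} → P x → Q x) → ∀ {y xs} → y ∈ xs → ¬ P y → Q y →
                 count P? xs < count Q? xs
  count-mono-< P⊆Q {xs = x ∷ xs} (here refl) ¬py qy with P? x | Q? x
  ... | yes py | _     = ⊥-elim (¬py py)
  ... | no _   | yes _ = s≤s (count-mono P⊆Q xs)
  ... | no _   | no ¬qy = ⊥-elim (¬qy qy)
  count-mono-< P⊆Q {xs = x ∷ xs} (there y∈xs) ¬py qy with P? x | Q? x
  ... | yes _  | yes _ = s≤s (count-mono-< P⊆Q y∈xs ¬py qy)
  ... | yes px | no ¬qx = ⊥-elim (¬qx (P⊆Q px))
  ... | no _   | yes _ = m≤n⇒m≤1+n (count-mono-< P⊆Q y∈xs ¬py qy)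
  ... | no _   | no _ = count-mono-< P⊆Q y∈xs ¬py qy

module _ {A : Set} {P Q R : Pred A 0ℓ} (P? : Decidable P) (Q? : Decidable Q) (R? : Decidable R) where

  count-⊎ : (∀ {x} → P x ⇔ (Q x ⊎ R x)) → (∀ {x} → Q x → ¬ R x) →
            ∀ xs → count P? xs ≡ count Q? xs + count R? xs
  count-⊎ P⇔Q⊎R Q⇒¬R [] = refl
  count-⊎ P⇔Q⊎R Q⇒¬R (x ∷ xs) with P? x | Q? x | R? x
  ... | yes _ | yes _  | no _   = cong suc (count-⊎ P⇔Q⊎R Q⇒¬R xs)
  ... | yes _ | no _   | yes _  = trans (cong suc (count-⊎ P⇔Q⊎R Q⇒¬R xs)) (sym (+-suc _ _))
  ... | no _  | no _   | no _   = count-⊎ P⇔Q⊎R Q⇒¬R xs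
  ... | _     | yes q  | yes r  = ⊥-elim (Q⇒¬R q r)
  ... | yes p | no ¬q  | no ¬r  = ⊥-elim ([ ¬q , ¬r ] (Equivalence.to P⇔Q⊎R p))
  ... | no ¬p | yes q  | _      = ⊥-elim (¬p (Equivalence.from P⇔Q⊎R (inj₁ q)))
  ... | no ¬p | _      | yes r  = ⊥-elim (¬p (Equivalence.from P⇔Q⊎R (inj₂ r)))

module _ {A B : Set} {P : Pred A 0ℓ} {Q : Pred B 0ℓ} (P? : Decidable P) (Q? : Decidable Q) where

  count-map-cong : (f : B → A) → (∀ x → P (f x) ⇔ Q x) →
                   ∀ xs → count P? (List.map f xs) ≡ count Q? xs
  count-map-cong f P∘f⇔Q [] = refl
  count-map-cong f P∘f⇔Q (x ∷ xs) with P? (f x) | Q? x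
  ... | yes _  | yes _  = cong suc (count-map-cong f P∘f⇔Q xs)
  ... | yes p  | no ¬q  = ⊥-elim (¬q (Equivalence.to (P∘f⇔Q x) p))
  ... | no ¬p  | yes q  = ⊥-elim (¬p (Equivalence.from (P∘f⇔Q x) q))
  ... | no _   | no _   = count-map-cong f P∘f⇔Q xs

  count-tabulate-cong : ∀ {n} (f : Fin n → A) (g : Fin n → B) → (∀ i → P (f i) ⇔ Q (g i)) →
                        count P? (tabulate f) ≡ count Q? (tabulate g)
  count-tabulate-cong {zero} f g P∘f⇔Q∘g = refl
  count-tabulate-cong {suc n} f g P∘f⇔Q∘g with P? (f zero) | Q? (g zero)
  ... | yes _  | yes _  = cong suc (count-tabulate-cong (f ∘ suc) (g ∘ suc) (P∘f⇔Q∘g ∘ suc))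
  ... | yes p  | no ¬q  = ⊥-elim (¬q (Equivalence.to (P∘f⇔Q∘g zero) p))
  ... | no ¬p  | yes q  = ⊥-elim (¬p (Equivalence.from (P∘f⇔Q∘g zero) q))
  ... | no _   | no _   = count-tabulate-cong (f ∘ suc) (g ∘ suc) (P∘f⇔Q∘g ∘ suc)

count-≟-unique : ∀ {v xs} → Unique xs → v ∈ xs → count (_≟ v) xs ≡ 1
count-≟-unique {xs = x ∷ xs} (x≢xs ∷ _) (here refl) = begin
  count (_≟ x) (x ∷ xs) ≡⟨ count-accept (_≟ x) refl ⟩
  suc (count (_≟ x) xs) ≡⟨ cong suc (count-none (_≟ x) (All.map (λ x≢y y≡x → x≢y (sym y≡x)) x≢xs)) ⟩
  1                     ∎
  where open ≡-Reasoning
count-≟-unique {v} {x ∷ xs} (x≢xs ∷ unique) (there v∈xs) =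
  trans (count-reject (_≟ v) (λ x≡v → All.lookup x≢xs v∈xs x≡v)) (count-≟-unique unique v∈xs)

count≤-standard : ∀ {N xs} → Unique xs → All (1 ≤_) xs → (∀ v → 1 ≤ v → v ≤ N → v ∈ xs) →
                  ∀ w → w ≤ N → count (_≤? w) xs ≡ w
count≤-standard positive unique covers zero _ = count-none (_≤? 0) (All.map <⇒≱ unique)
count≤-standard {N} {xs} unique positive covers (suc w) 1+w≤N = begin
  count (_≤? suc w) xs                          ≡⟨ count-⊎ (_≤? suc w) (_≤? w) (_≟ suc w) ≤-suc⇔
                                                     (λ x≤w x≡1+w → 1+n≰n (subst (_≤ w) x≡1+w x≤w)) xs ⟩
  count (_≤? w) xs + count (_≟ suc w) xs        ≡⟨ cong₂ _+_ (count≤-standard unique positive covers w (<⇒≤ 1+w≤N))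
                                                                 (count-≟-unique unique (covers (suc w) (s≤s z≤n) 1+w≤N)) ⟩
  w + 1                                         ≡⟨ +-comm w 1 ⟩
  suc w                                         ∎
  where
  open ≡-Reasoning
  ≤-suc⇔ : ∀ {x} → x ≤ suc w ⇔ (x ≤ w ⊎ x ≡ suc w)
  ≤-suc⇔ = mk⇔ (Sum.map₁ s≤s⁻¹ ∘ m≤n⇒m<n∨m≡n) [ m≤n⇒m≤1+n , ≤-reflexive ]

countBelow : ∀ {n} → (Fin n → ℕ) → ℕ → ℕ
countBelow f w = count (_<? w) (tabulate f)

countBelow-≤ : ∀ {n} (f : Fin n → ℕ) w → countBelow f w ≤ n
countBelow-≤ f w = subst (countBelow f w ≤_) (length-tabulate f) (length-filter (_<? w) (tabulate f))

countBelow-mono : ∀ {n} (f : Fin n → ℕ) {w w'} → w ≤ w' → countBelow f w ≤ countBelow f w'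
countBelow-mono f w≤w' = count-mono (_<? _) (_<? _) (λ x<w → <-≤-trans x<w w≤w') (tabulate f)

module _ {P : Pred ℕ 0ℓ} (P? : Decidable P) (P-down : ∀ {x y} → x ≤ y → P y → P x) where

  <-count-tabulate⇔ : ∀ {n} (f : Fin n → ℕ) → Monotonic₁ Fin._≤_ _≤_ f →
                      ∀ i → toℕ i < count P? (tabulate f) ⇔ P (f i)
  <-count-tabulate⇔ {suc n} f mono i with P? (f zero)
  ... | yes pf₀ = shifted i
    where
    shifted : ∀ i → toℕ i < suc (count P? (tabulate (f ∘ suc))) ⇔ P (f i)
    shifted zero    = mk⇔ (λ _ → pf₀) (λ _ → s≤s z≤n)
    shifted (suc i) = let IH = <-count-tabulate⇔ (f ∘ suc) (mono ∘ s≤s) i in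
                      mk⇔ (Equivalence.to IH ∘ s≤s⁻¹) (s≤s ∘ Equivalence.from IH)
  ... | no ¬pf₀ = mk⇔ (λ i<0 → ⊥-elim (n≮0 (subst (toℕ i <_) none i<0)))
                      (λ pfi → ⊥-elim (¬pf₀ (P-down (mono z≤n) pfi)))
    where
    none : count P? (tabulate (f ∘ suc)) ≡ 0
    none = count-none P? (tabulate⁺ {f = f ∘ suc} (λ j pfj → ¬pf₀ (P-down (mono z≤n) pfj)))

<-countBelow⇔ : ∀ {n} (f : Fin n → ℕ) → Monotonic₁ Fin._≤_ _≤_ f →
                ∀ w i → toℕ i < countBelow f w ⇔ f i < w
<-countBelow⇔ f mono w = <-count-tabulate⇔ (_<? w) ≤-<-trans f mono

countBelow-toℕ : ∀ {n} x → x ≤ n → countBelow (toℕ {n}) x ≡ x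
countBelow-toℕ {n}     zero    _          = count-none (_<? 0) (tabulate⁺ {f = toℕ {n}} (λ _ → n≮0))
countBelow-toℕ {suc n} (suc x) (s≤s x≤n) = begin
  count (_<? suc x) (0 ∷ tabulate (suc ∘ toℕ {n}))    ≡⟨ count-accept (_<? suc x) {xs = tabulate (suc ∘ toℕ {n})} (s≤s z≤n) ⟩
  suc (count (_<? suc x) (tabulate (suc ∘ toℕ {n}))) ≡⟨ cong suc (count-tabulate-cong (_<? suc x) (_<? x) (suc ∘ toℕ) (toℕ {n})
                                                            (λ _ → mk⇔ s≤s⁻¹ s≤s)) ⟩
  suc (countBelow (toℕ {n}) x)                         ≡⟨ cong suc (countBelow-toℕ x x≤n) ⟩
  suc x                                          ∎
  where open ≡-Reasoning

-- Arrays and red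

toList≡tabulate-lookup : ∀ {A : Set} {n} (xs : Vec A n) → toList xs ≡ tabulate (lookup xs)
toList≡tabulate-lookup []       = refl
toList≡tabulate-lookup (x ∷ xs) = cong (x ∷_) (toList≡tabulate-lookup xs)

entries : ∀ {n r} → Vec (Vec ℕ n) r → List ℕ
entries V = List.concat (toList (Vec.map toList V))

∈-entries : ∀ {n r} (V : Vec (Vec ℕ n) r) i j → lookup (lookup V i) j ∈ entries V
∈-entries (row ∷ V) zero    j = ∈-++⁺ˡ (subst (lookup row j ∈_) (sym (toList≡tabulate-lookup row)) (∈-tabulate⁺ j))
∈-entries (row ∷ V) (suc i) j = ∈-++⁺ʳ (toList row) (∈-entries V i j)

∈-entries⁻ : ∀ {n r} (V : Vec (Vec ℕ n) r) {x} → x ∈ entries V → ∃₂ λ i j → x ≡ lookup (lookup V i) j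
∈-entries⁻ (row ∷ V) x∈ with ∈-++⁻ (toList row) x∈
... | inj₁ x∈row = let j , x≡ = ∈-tabulate⁻ (subst (_ ∈_) (toList≡tabulate-lookup row) x∈row) in zero , j , x≡
... | inj₂ x∈V   = let i , j , x≡ = ∈-entries⁻ V x∈V in suc i , j , x≡

entries-unique : ∀ {n r} (V : Vec (Vec ℕ n) r) →
                 (∀ i j i' j' → lookup (lookup V i) j ≡ lookup (lookup V i') j' → i ≡ i' × j ≡ j') →
                 Unique (entries V)
entries-unique []        _   = []
entries-unique (row ∷ V) inj = Unique.++⁺ uniqueRow (entries-unique V injV) disjoint
  where
  uniqueRow = subst Unique (sym (toList≡tabulate-lookup row)) (Unique.tabulate⁺ (λ e → proj₂ (inj zero _ zero _ e)))
  injV = λ i j i' j' e → let i≡i' , j≡j' = inj (suc i) j (suc i') j' e in Fin-suc-injective i≡i' , j≡j'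
  disjoint : ∀ {x} → ¬ (x ∈ toList row × x ∈ entries V)
  disjoint (x∈row , x∈V) =
    let j , x≡ = ∈-tabulate⁻ (subst (_ ∈_) (toList≡tabulate-lookup row) x∈row)
        i , j' , x≡' = ∈-entries⁻ V x∈V
    in Fin-0≢1+n (proj₁ (inj zero j (suc i) j' (trans (sym x≡) x≡')))

entries-map : ∀ {n r} (f : ℕ → ℕ) (V : Vec (Vec ℕ n) r) → entries (Vec.map (Vec.map f) V) ≡ List.map f (entries V)
entries-map f []        = refl
entries-map f (row ∷ V) = trans (cong₂ _++_ (toList-map f row) (entries-map f V)) (sym (map-++ f (toList row) (entries V)))

count≤-entries : ∀ {k n} {T : Array k n} → IsT k n T → ∀ w → w ≤ suc k * n → count (_≤? w) (entries T) ≡ w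
count≤-entries {T = T} t = count≤-standard (entries-unique T (IsT.injective t)) positive covered
  where
  positive = All.tabulate λ x∈ → let i , j , x≡ = ∈-entries⁻ T x∈ in subst (1 ≤_) (sym x≡) (proj₁ (IsT.inRange t i j))
  covered = λ v 1≤v v≤N → let i , j , e = IsT.covers t v 1≤v v≤N in subst (_∈ entries T) e (∈-entries T i j)

count-entries-split : ∀ {n r} {P : Pred ℕ 0ℓ} (P? : Decidable P) (V : Vec (Vec ℕ (suc n)) r) →
  count P? (entries V) ≡ count P? (tabulate (λ i → lookup (lookup V i) zero)) + count P? (entries (Vec.map dropFirst V))
count-entries-split P? [] = refl
count-entries-split P? ((y ∷ row) ∷ V) = begin
  count P? (y ∷ toList row ++ entries V)                         ≡⟨ count-++ P? List.[ y ] _ ⟩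
  cy + count P? (toList row ++ entries V)                        ≡⟨ cong (cy +_) (count-++ P? (toList row) _) ⟩
  cy + (cr + count P? (entries V))                               ≡⟨ cong (λ c → cy + (cr + c)) (count-entries-split P? V) ⟩
  cy + (cr + (ch + ce))                                          ≡⟨ +-assoc cy cr _ ⟨
  (cy + cr) + (ch + ce)                                          ≡⟨ +-interchange cy cr ch ce ⟩
  (cy + ch) + (cr + ce)                                          ≡⟨ cong₂ _+_ (count-++ P? List.[ y ] _) (count-++ P? (toList row) _) ⟨
  count P? (y ∷ tabulate (λ i → lookup (lookup V i) zero)) + count P? (toList row ++ entries (Vec.map dropFirst V)) ∎
  where
  open ≡-Reasoning
  cy = count P? List.[ y ]
  cr = count P? (toList row)
  ch = count P? (tabulate (λ i → lookup (lookup V i) zero))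
  ce = count P? (entries (Vec.map dropFirst V))

lookup-map-dropFirst : ∀ {A : Set} {n r} (V : Vec (Vec A (suc n)) r) i j →
                       lookup (lookup (Vec.map dropFirst V) i) j ≡ lookup (lookup V i) (suc j)
lookup-map-dropFirst ((_ ∷ _) ∷ V) zero    j = refl
lookup-map-dropFirst (row ∷ V) (suc i) j = lookup-map-dropFirst V i j

redRank : ∀ {k n} → Array k (suc n) → ℕ → ℕ
redRank T x = count (_≤? x) (entries (Vec.map dropFirst T))

entry-red : ∀ {k n} (T : Array k (suc n)) i j → entry (red T) i j ≡ redRank T (entry T i (suc j))
entry-red T i j = begin
  lookup (lookup (Vec.map (Vec.map (redRank T)) (Vec.map dropFirst T)) i) j ≡⟨ cong (λ row → lookup row j)
                                                                                  (lookup-map i (Vec.map (redRank T)) (Vec.map dropFirst T)) ⟩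
  lookup (Vec.map (redRank T) (lookup (Vec.map dropFirst T) i)) j          ≡⟨ lookup-map j (redRank T) (lookup (Vec.map dropFirst T) i) ⟩
  redRank T (lookup (lookup (Vec.map dropFirst T) i) j)                      ≡⟨ cong (redRank T) (lookup-map-dropFirst T i j) ⟩
  redRank T (entry T i (suc j))                                              ∎
  where open ≡-Reasoning

Array-ext : ∀ {k n} {T U : Array k n} → (∀ i j → entry T i j ≡ entry U i j) → T ≡ U
Array-ext T≗U = lookup-ext (λ i → lookup-ext (T≗U i))
  where
  lookup-ext : ∀ {A : Set} {n} {xs ys : Vec A n} → (∀ i → lookup xs i ≡ lookup ys i) → xs ≡ ys
  lookup-ext {xs = xs} {ys} xs≗ys = trans (sym (tabulate∘lookup xs)) (trans (tabulate-cong xs≗ys) (tabulate∘lookup ys))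

last≡lookup-fromℕ : ∀ {A : Set} {n} (xs : Vec A (suc n)) → last xs ≡ lookup xs (fromℕ n)
last≡lookup-fromℕ (x ∷ [])     = refl
last≡lookup-fromℕ (x ∷ y ∷ xs) = last≡lookup-fromℕ (y ∷ xs)

lookup-last≡entry : ∀ {k n} (T : Array k n) j → lookup (last T) j ≡ entry T (fromℕ k) j
lookup-last≡entry T j = cong (λ row → lookup row j) (last≡lookup-fromℕ T)

head-last≡entry : ∀ {k n} (T : Array k (suc n)) → head (last T) ≡ entry T (fromℕ k) zero
head-last≡entry {k} T = trans (cong head (last≡lookup-fromℕ T)) (head≡lookup-zero (lookup T (fromℕ k)))
  where
  head≡lookup-zero : ∀ {A : Set} {n} (xs : Vec A (suc n)) → head xs ≡ lookup xs zero
  head≡lookup-zero (_ ∷ _) = refl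

-- Extensions of T' by a new first column

module Extensions (k m : ℕ) (T' : Array k (suc m)) (t' : IsT k (suc m) T') where

  E' : Fin (suc k) → Fin (suc m) → ℕ
  E' = entry T'

  N' : ℕ
  N' = suc k * suc m

  b₁' : ℕ
  b₁' = head (last T')

  E'-positive : ∀ i j → 1 ≤ E' i j
  E'-positive i j = proj₁ (IsT.inRange t' i j)

  E'-≤ : ∀ i j → E' i j ≤ N'
  E'-≤ i j = proj₂ (IsT.inRange t' i j)

  b₁'≡E' : b₁' ≡ E' (fromℕ k) zero
  b₁'≡E' = head-last≡entry T'

  b₁'≤N' : b₁' ≤ N'
  b₁'≤N' = subst (_≤ N') (sym b₁'≡E') (E'-≤ (fromℕ k) zero)

  module E'-row (i : Fin (suc k)) = StrictlyIncreasing toℕ toℕ-injective (λ {j} {j'} → IsT.rowInc t' i j j')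
  module E'-column (j : Fin (suc m)) = StrictlyIncreasing toℕ toℕ-injective (λ {i} {i'} → IsT.colInc t' i i' j)

  E'-step : ∀ (i : Fin k) j → E' (inject₁ i) j < E' (suc i) j
  E'-step i j = IsT.colInc t' (inject₁ i) (suc i) j (inject₁<suc i)

  candidate : ℕ → Fin k → Fin (suc m) → ℕ
  candidate q i j = E' (inject₁ i) j onlyIf (E' (suc i) j ≤? q)

  -- If the new first-column entry of row i + 1 exceeds exactly q entries of T', the one of row i exceeds
  -- exactly rankAbove q of them: the largest entry of T' whose lower neighbour is at most q (0 if none).
  rankAbove : ℕ → ℕ
  rankAbove q = max (λ i → max (candidate q i))

  ≤-rankAbove : ∀ i j {q} → E' (suc i) j ≤ q → E' (inject₁ i) j ≤ rankAbove q
  ≤-rankAbove i j {q} E'≤q = begin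
    E' (inject₁ i) j        ≡⟨ onlyIf-yes _ (E' (suc i) j ≤? q) E'≤q ⟨
    candidate q i j         ≤⟨ ≤-max (candidate q i) j ⟩
    max (candidate q i)     ≤⟨ ≤-max (λ i → max (candidate q i)) i ⟩
    rankAbove q             ∎
    where open ≤-Reasoning

  rankAbove-attained : ∀ q → rankAbove q ≡ 0 ⊎ ∃₂ λ i j → rankAbove q ≡ E' (inject₁ i) j × E' (suc i) j ≤ q
  rankAbove-attained q with max-attained (λ i → max (candidate q i))
  ... | inj₁ ≡0 = inj₁ ≡0
  ... | inj₂ (i , ≡rowMax) with max-attained (candidate q i)
  ...   | inj₁ ≡0 = inj₁ (trans ≡rowMax ≡0)
  ...   | inj₂ (j , ≡value) with onlyIf-cases (E' (inject₁ i) j) (E' (suc i) j ≤? q)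
  ...     | inj₁ ≡0 = inj₁ (trans ≡rowMax (trans ≡value ≡0))
  ...     | inj₂ (E'≤q , ≡E') = inj₂ (i , j , trans ≡rowMax (trans ≡value ≡E') , E'≤q)

  rankAbove-≤ : ∀ q → rankAbove q ≤ q
  rankAbove-≤ q with rankAbove-attained q
  ... | inj₁ ≡0 = subst (_≤ q) (sym ≡0) z≤n
  ... | inj₂ (i , j , ≡E' , E'≤q) = subst (_≤ q) (sym ≡E') (≤-trans (<⇒≤ (E'-step i j)) E'≤q)

  rankAbove-< : ∀ i j {q} → q < E' (suc i) j → rankAbove q < E' (inject₁ i) j
  rankAbove-< i j {q} q<E' with rankAbove-attained q
  ... | inj₁ ≡0 = subst (_< E' (inject₁ i) j) (sym ≡0) (E'-positive (inject₁ i) j)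
  ... | inj₂ (i₀ , j₀ , ≡E' , E'≤q) rewrite ≡E' with <-cmp (E' (inject₁ i₀) j₀) (E' (inject₁ i) j)
  ...   | tri< lt _ _ = lt
  ...   | tri≈ _ eq _ = let i₀≡i , j₀≡j = IsT.injective t' (inject₁ i₀) j₀ (inject₁ i) j eq in
                        ⊥-elim (<-irrefl refl (<-≤-trans q<E'
                          (subst₂ (λ i' j' → E' (suc i') j' ≤ q) (inject₁-injective i₀≡i) j₀≡j E'≤q)))
  ...   | tri> _ _ gt = ⊥-elim (IsT.avoids t' i j (inject₁ i₀) (suc i₀) j₀ gt (E'-step i₀ j₀) (≤-<-trans E'≤q q<E'))

  -- The candidate extension whose new bottom-left entry exceeds exactly P entries of T':
  -- row i starts with column i, and an entry w of T' becomes shift w.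
  module Construction (P : ℕ) where

    rank : Fin (suc k) → ℕ
    rank i = fold P rankAbove (k ∸ toℕ i)

    rank-last : rank (fromℕ k) ≡ P
    rank-last = cong (fold P rankAbove) (trans (cong (k ∸_) (toℕ-fromℕ k)) (n∸n≡0 k))

    rank-step : ∀ (i : Fin k) → rank (inject₁ i) ≡ rankAbove (rank (suc i))
    rank-step i = cong (fold P rankAbove) (trans (cong (k ∸_) (toℕ-inject₁ i)) (m∸n≡1+[m∸1+n] (toℕ<n i)))

    rank-mono : Monotonic₁ Fin._≤_ _≤_ rank
    rank-mono = stepwise-monotone rank (λ i → subst (_≤ rank (suc i)) (sym (rank-step i)) (rankAbove-≤ _))

    rank-≤ : ∀ i → rank i ≤ P
    rank-≤ i = subst (rank i ≤_) rank-last (rank-mono (≤fromℕ i))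

    column : Fin (suc k) → ℕ
    column i = suc (rank i + toℕ i)

    column-strict : ∀ {i j} → toℕ i < toℕ j → column i < column j
    column-strict i<j = s≤s (+-mono-≤-< (rank-mono (<⇒≤ i<j)) i<j)

    module Column = StrictlyIncreasing toℕ toℕ-injective column-strict

    shift : ℕ → ℕ
    shift w = w + countBelow rank w

    shift-strict : ∀ {w w'} → w < w' → shift w < shift w'
    shift-strict w<w' = +-mono-<-≤ w<w' (countBelow-mono rank (<⇒≤ w<w'))

    module Shift = StrictlyIncreasing (λ w → w) (λ w≡w' → w≡w') shift-strict

    <-countBelow-rank⇔ : ∀ w i → toℕ i < countBelow rank w ⇔ rank i < w
    <-countBelow-rank⇔ = <-countBelow⇔ rank rank-mono

    rank<⇒column<shift : ∀ i {w} → rank i < w → column i < shift w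
    rank<⇒column<shift i {w} rank<w =
      ≤-<-trans (+-monoˡ-≤ (toℕ i) rank<w) (+-monoʳ-< w (Equivalence.from (<-countBelow-rank⇔ w i) rank<w))

    ≤rank⇒shift<column : ∀ i {w} → w ≤ rank i → shift w < column i
    ≤rank⇒shift<column i {w} w≤rank =
      s≤s (+-mono-≤ w≤rank (≮⇒≥ (λ i<c → <⇒≱ (Equivalence.to (<-countBelow-rank⇔ w i) i<c) w≤rank)))

    column<shift⇒ : ∀ i {w} → column i < shift w → rank i < w
    column<shift⇒ i lt = ≰⇒> (λ w≤rank → <-asym lt (≤rank⇒shift<column i w≤rank))

    shift<column⇒ : ∀ i {w} → shift w < column i → w ≤ rank i
    shift<column⇒ i lt = ≮⇒≥ (λ rank<w → <-asym lt (rank<⇒column<shift i rank<w))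

    column≢shift : ∀ i w → column i ≢ shift w
    column≢shift i w eq with rank i <? w
    ... | yes rank<w = <-irrefl eq (rank<⇒column<shift i rank<w)
    ... | no rank≮w  = <-irrefl (sym eq) (≤rank⇒shift<column i (≮⇒≥ rank≮w))

    extendedEntry : Fin (suc k) → Fin (suc (suc m)) → ℕ
    extendedEntry i zero    = column i
    extendedEntry i (suc j) = shift (E' i j)

    extended : Array k (suc (suc m))
    extended = Vec.tabulate (λ i → Vec.tabulate (extendedEntry i))

    entry-extended : ∀ i j → entry extended i j ≡ extendedEntry i j
    entry-extended i j = trans (cong (λ row → lookup row j) (lookup∘tabulate (λ i → Vec.tabulate (extendedEntry i)) i))
                               (lookup∘tabulate (extendedEntry i) j)

    dropFirst-extended : Vec.map dropFirst extended ≡ Vec.map (Vec.map shift) T'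
    dropFirst-extended = Array-ext λ i j → begin
      lookup (lookup (Vec.map dropFirst extended) i) j  ≡⟨ lookup-map-dropFirst extended i j ⟩
      entry extended i (suc j)                          ≡⟨ entry-extended i (suc j) ⟩
      shift (E' i j)                                    ≡⟨ lookup-map j shift (lookup T' i) ⟨
      lookup (Vec.map shift (lookup T' i)) j            ≡⟨ cong (λ row → lookup row j) (lookup-map i (Vec.map shift) T') ⟨
      lookup (lookup (Vec.map (Vec.map shift) T') i) j  ∎
      where open ≡-Reasoning

    red-extended : red extended ≡ T'
    red-extended = Array-ext λ i j → begin
      entry (red extended) i j                              ≡⟨ entry-red extended i j ⟩
      redRank extended (entry extended i (suc j))           ≡⟨ cong (redRank extended) (entry-extended i (suc j)) ⟩
      redRank extended (shift (E' i j))                     ≡⟨ cong (count (_≤? shift (E' i j)) ∘ entries) dropFirst-extended ⟩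
      count (_≤? shift (E' i j)) (entries (Vec.map (Vec.map shift) T')) ≡⟨ cong (count (_≤? shift (E' i j))) (entries-map shift T') ⟩
      count (_≤? shift (E' i j)) (List.map shift (entries T'))          ≡⟨ count-map-cong (_≤? shift (E' i j)) (_≤? E' i j) shift
                                                                              (λ _ → mk⇔ Shift.reflects-≤ Shift.monotone) (entries T') ⟩
      count (_≤? E' i j) (entries T')                       ≡⟨ count≤-entries t' (E' i j) (E'-≤ i j) ⟩
      E' i j                                                ∎
      where open ≡-Reasoning

    head-last-extended : head (last extended) ≡ suc (P + k)
    head-last-extended = trans (head-last≡entry extended)
      (trans (entry-extended (fromℕ k) zero) (cong suc (cong₂ _+_ rank-last (toℕ-fromℕ k))))

    module _ (P<b₁' : P < b₁') where

      rank<E' : ∀ i → rank i < E' i zero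
      rank<E' = >-weakInduction (λ i → rank i < E' i zero) last-row step
        where
        last-row = subst₂ _<_ (sym rank-last) b₁'≡E' P<b₁'
        step = λ i rank<E' → subst (_< E' (inject₁ i) zero) (sym (rank-step i)) (rankAbove-< i zero rank<E')

      P≤N' : P ≤ N'
      P≤N' = <⇒≤ (<-≤-trans P<b₁' b₁'≤N')

      extended-size : suc k * suc (suc m) ≡ N' + suc k
      extended-size = trans (*-suc (suc k) (suc m)) (+-comm (suc k) N')

      extendedEntry-inRange : ∀ i j → 1 ≤ extendedEntry i j × extendedEntry i j ≤ N' + suc k
      extendedEntry-inRange i zero    = s≤s z≤n , subst (_≤ N' + suc k) (+-suc (rank i) (toℕ i))
                                                        (+-mono-≤ (≤-trans (rank-≤ i) P≤N') (toℕ<n i))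
      extendedEntry-inRange i (suc j) = ≤-trans (E'-positive i j) (m≤m+n _ _) ,
                                        +-mono-≤ (E'-≤ i j) (countBelow-≤ rank (E' i j))

      extendedEntry-rowInc : ∀ i j j' → j Fin.< j' → extendedEntry i j < extendedEntry i j'
      extendedEntry-rowInc i zero    (suc j') _          = rank<⇒column<shift i (<-≤-trans (rank<E' i) (E'-row.monotone i z≤n))
      extendedEntry-rowInc i (suc j) (suc j') (s≤s j<j') = shift-strict (IsT.rowInc t' i j j' j<j')

      extendedEntry-colInc : ∀ i i' j → i Fin.< i' → extendedEntry i j < extendedEntry i' j
      extendedEntry-colInc i i' zero    = column-strict
      extendedEntry-colInc i i' (suc j) = shift-strict ∘ IsT.colInc t' i i' j

      extendedEntry-injective : ∀ i j i' j' → extendedEntry i j ≡ extendedEntry i' j' → i ≡ i' × j ≡ j'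
      extendedEntry-injective i zero    i' zero     eq = Column.injective eq , refl
      extendedEntry-injective i zero    i' (suc j') eq = ⊥-elim (column≢shift i (E' i' j') eq)
      extendedEntry-injective i (suc j) i' zero     eq = ⊥-elim (column≢shift i' (E' i j) (sym eq))
      extendedEntry-injective i (suc j) i' (suc j') eq =
        let i≡i' , j≡j' = IsT.injective t' i j i' j' (Shift.injective eq) in i≡i' , cong suc j≡j'

      avoids-columns : ∀ (i : Fin k) i₁ i₂ → column (inject₁ i) < column i₁ → column i₁ < column i₂ →
                       column i₂ < column (suc i) → ⊥
      avoids-columns i i₁ i₂ c₀<c₁ c₁<c₂ c₂<c₃ =
        <⇒≱ (≤-<-trans (≤-reflexive (sym (toℕ-inject₁ i))) (Column.reflects-< {inject₁ i} {i₁} c₀<c₁))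
            (≤-trans (<⇒≤ (Column.reflects-< {i₁} {i₂} c₁<c₂)) (s≤s⁻¹ (Column.reflects-< {i₂} {suc i} c₂<c₃)))

      avoids-column-shift : ∀ (i : Fin k) i₁ i₂ s → column (inject₁ i) < shift (E' i₁ s) →
                            shift (E' i₁ s) < shift (E' i₂ s) → shift (E' i₂ s) < column (suc i) → ⊥
      avoids-column-shift i i₁ i₂ s c<x x<y y<c with <⇒inject₁ (E'-column.reflects-< s (Shift.reflects-< x<y))
      ... | r , refl = <⇒≱ (column<shift⇒ (inject₁ i) c<x) (begin
        E' (inject₁ r) s              ≤⟨ ≤-rankAbove r s (≤-trans E'-below (shift<column⇒ (suc i) y<c)) ⟩
        rankAbove (rank (suc i))      ≡⟨ rank-step i ⟨
        rank (inject₁ i)              ∎)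
        where
        open ≤-Reasoning
        E'-below : E' (suc r) s ≤ E' i₂ s
        E'-below = E'-column.monotone s (subst (_< toℕ i₂) (toℕ-inject₁ r) (E'-column.reflects-< s (Shift.reflects-< x<y)))

      avoids-shift-column : ∀ (i : Fin k) i₁ i₂ s → shift (E' (inject₁ i) s) < column i₁ →
                            column i₁ < column i₂ → column i₂ < shift (E' (suc i) s) → ⊥
      avoids-shift-column i i₁ i₂ s x<c c<c' c'<y with <⇒inject₁ (Column.reflects-< {i₁} {i₂} c<c')
      ... | r , refl = <⇒≱ (begin-strict
        rank (inject₁ r)          ≡⟨ rank-step r ⟩
        rankAbove (rank (suc r))  <⟨ rankAbove-< i s (≤-<-trans rank-below (column<shift⇒ i₂ c'<y)) ⟩
        E' (inject₁ i) s          ∎) (shift<column⇒ (inject₁ r) x<c)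
        where
        open ≤-Reasoning
        rank-below : rank (suc r) ≤ rank i₂
        rank-below = rank-mono (subst (_< toℕ i₂) (toℕ-inject₁ r) (Column.reflects-< {inject₁ r} {i₂} c<c'))

      extendedEntry-avoids : ∀ (i : Fin k) j i₁ i₂ j' →
                             extendedEntry (inject₁ i) j < extendedEntry i₁ j' → extendedEntry i₁ j' < extendedEntry i₂ j' →
                             extendedEntry i₂ j' < extendedEntry (suc i) j → ⊥
      extendedEntry-avoids i zero    i₁ i₂ zero     = avoids-columns i i₁ i₂
      extendedEntry-avoids i zero    i₁ i₂ (suc s)  = avoids-column-shift i i₁ i₂ s
      extendedEntry-avoids i (suc s) i₁ i₂ zero     = avoids-shift-column i i₁ i₂ s
      extendedEntry-avoids i (suc s) i₁ i₂ (suc s') a<b b<c c<d =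
        IsT.avoids t' i s i₁ i₂ s' (Shift.reflects-< a<b) (Shift.reflects-< b<c) (Shift.reflects-< c<d)

      -- Exactly t new entries lie below v, so v = shift (v ∸ t).
      module ShiftPreimage {v} (1≤v : 1 ≤ v) (v≤N : v ≤ N' + suc k) (column≢v : ∀ i → column i ≢ v) where

        t : ℕ
        t = countBelow column v

        w : ℕ
        w = v ∸ t

        <t⇔ : ∀ i → toℕ i < t ⇔ column i < v
        <t⇔ = <-countBelow⇔ column Column.monotone v

        rank+t<v : ∀ i → toℕ i < t → rank i + t < v
        rank+t<v i i<t with predIndex (countBelow-≤ column v) (≤-<-trans z≤n i<t)
        ... | j , 1+j≡t = begin-strict
          rank i + t            ≤⟨ +-monoˡ-≤ t (rank-mono {i} {j} (s≤s⁻¹ (subst (toℕ i <_) (sym 1+j≡t) i<t))) ⟩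
          rank j + t            ≡⟨ cong (rank j +_) 1+j≡t ⟨
          rank j + suc (toℕ j)  ≡⟨ +-suc (rank j) (toℕ j) ⟩
          column j              <⟨ Equivalence.to (<t⇔ j) (≤-reflexive 1+j≡t) ⟩
          v                     ∎
          where open ≤-Reasoning

        v≤rank+t : ∀ i → t ≤ toℕ i → v ≤ rank i + t
        v≤rank+t i t≤i = begin
          v                 ≤⟨ s≤s⁻¹ v<column ⟩
          rank j + toℕ j    ≡⟨ cong (rank j +_) j≡t ⟩
          rank j + t        ≤⟨ +-monoˡ-≤ t (rank-mono {j} {i} (subst (_≤ toℕ i) (sym j≡t) t≤i)) ⟩
          rank i + t        ∎
          where
          open ≤-Reasoning
          t<1+k = ≤-<-trans t≤i (toℕ<n i)
          j = fromℕ< t<1+k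
          j≡t = toℕ-fromℕ< t<1+k
          v<column : v < column j
          v<column = ≤∧≢⇒< (≮⇒≥ (λ column<v → <-irrefl j≡t (Equivalence.from (<t⇔ j) column<v))) (column≢v j ∘ sym)

        rank<w⇔ : ∀ i → rank i < w ⇔ column i < v
        rank<w⇔ i = mk⇔
          (λ rank<w → ≰⇒> (λ v≤column → <⇒≱ rank<w (m≤n+o⇒m∸n≤o v t (subst (v ≤_) (+-comm (rank i) t)
                        (v≤rank+t i (≮⇒≥ (λ i<t → <⇒≱ (Equivalence.to (<t⇔ i) i<t) v≤column)))))))
          (λ column<v → m+n≤o⇒m≤o∸n (suc (rank i)) (rank+t<v i (Equivalence.from (<t⇔ i) column<v)))

        t<v : t < v
        t<v with m≤n⇒m<n∨m≡n (z≤n {t})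
        ... | inj₁ 0<t = ≤-<-trans (m≤n+m t (rank zero)) (rank+t<v zero 0<t)
        ... | inj₂ 0≡t = subst (_< v) 0≡t 1≤v

        1≤w : 1 ≤ w
        1≤w = m<n⇒0<n∸m t<v

        w≤N' : w ≤ N'
        w≤N' with m≤n⇒m<n∨m≡n (countBelow-≤ column v)
        ... | inj₁ t<1+k = let j = fromℕ< t<1+k in begin
          w        ≤⟨ m≤n+o⇒m∸n≤o v t (subst (v ≤_) (+-comm (rank j) t)
                                                  (v≤rank+t j (≤-reflexive (sym (toℕ-fromℕ< t<1+k))))) ⟩
          rank j   ≤⟨ rank-≤ j ⟩
          P        ≤⟨ P≤N' ⟩
          N'       ∎
          where open ≤-Reasoning
        ... | inj₂ t≡1+k = m≤n+o⇒m∸n≤o v t (subst (v ≤_) (trans (+-comm N' (suc k)) (cong (_+ N') (sym t≡1+k))) v≤N)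

        shift-w : shift w ≡ v
        shift-w = begin
          w + countBelow rank w   ≡⟨ cong (w +_) (count-tabulate-cong (_<? w) (_<? v) rank column rank<w⇔) ⟩
          w + t                   ≡⟨ +-comm w t ⟩
          t + (v ∸ t)             ≡⟨ m+[n∸m]≡n (<⇒≤ t<v) ⟩
          v                       ∎
          where open ≡-Reasoning

      extendedEntry-covers : ∀ v → 1 ≤ v → v ≤ N' + suc k → ∃₂ λ i j → extendedEntry i j ≡ v
      extendedEntry-covers v 1≤v v≤N with any? (λ i → column i ≟ v)
      ... | yes (i , column≡v) = i , zero , column≡v
      ... | no ¬column≡v =
        let open ShiftPreimage 1≤v v≤N (λ i eq → ¬column≡v (i , eq))
            i , j , E'≡w = IsT.covers t' w 1≤w w≤N'
        in i , suc j , trans (cong shift E'≡w) shift-w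

      extended-isT : IsT k (suc (suc m)) extended
      extended-isT = record
        { inRange   = λ i j → subst (λ x → 1 ≤ x × x ≤ suc k * suc (suc m)) (sym (entry-extended i j))
                                    (Product.map₂ (subst (extendedEntry i j ≤_) (sym extended-size)) (extendedEntry-inRange i j))
        ; covers    = λ v 1≤v v≤N → let i , j , e = extendedEntry-covers v 1≤v (subst (v ≤_) extended-size v≤N)
                                    in i , j , trans (entry-extended i j) e
        ; injective = λ i j i' j' eq → extendedEntry-injective i j i' j'
                                         (trans (sym (entry-extended i j)) (trans eq (entry-extended i' j')))
        ; rowInc    = λ i j j' j<j' → toEntries i j i j' (extendedEntry-rowInc i j j' j<j')
        ; colInc    = λ i i' j i<i' → toEntries i j i' j (extendedEntry-colInc i i' j i<i')
        ; avoids    = λ i j i₁ i₂ j' a<b b<c c<d → extendedEntry-avoids i j i₁ i₂ j' (fromEntries (inject₁ i) j i₁ j' a<b)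
                                                                    (fromEntries i₁ j' i₂ j' b<c) (fromEntries i₂ j' (suc i) j c<d)
        }
        where
        toEntries : ∀ a b c d → extendedEntry a b < extendedEntry c d → entry extended a b < entry extended c d
        toEntries a b c d = subst₂ _<_ (sym (entry-extended a b)) (sym (entry-extended c d))
        fromEntries : ∀ a b c d → entry extended a b < entry extended c d → extendedEntry a b < extendedEntry c d
        fromEntries a b c d = subst₂ _<_ (entry-extended a b) (entry-extended c d)

      bottom-row-extended : ∀ j → lookup (last extended) (suc j) ≡ lookup (last T') j + suc k
      bottom-row-extended j = begin
        lookup (last extended) (suc j)                  ≡⟨ lookup-last≡entry extended (suc j) ⟩
        entry extended (fromℕ k) (suc j)                ≡⟨ entry-extended (fromℕ k) (suc j) ⟩
        E' (fromℕ k) j + countBelow rank (E' (fromℕ k) j) ≡⟨ cong₂ _+_ (sym (lookup-last≡entry T' j)) all-ranks-below ⟩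
        lookup (last T') j + suc k                      ∎
        where
        open ≡-Reasoning
        P<E' : P < E' (fromℕ k) j
        P<E' = <-≤-trans P<b₁' (≤-trans (≤-reflexive b₁'≡E') (E'-row.monotone (fromℕ k) z≤n))
        all-ranks-below : countBelow rank (E' (fromℕ k) j) ≡ suc k
        all-ranks-below = trans (count-all (_<? E' (fromℕ k) j) (tabulate⁺ (λ i → ≤-<-trans (rank-≤ i) P<E')))
                                (length-tabulate rank)

  extend : ℕ → Array k (suc (suc m))
  extend = Construction.extended

  IsExtension : Array k (suc (suc m)) → Set
  IsExtension T = IsT k (suc (suc m)) T × red T ≡ T'

  module Reconstruction {T : Array k (suc (suc m))} (t : IsT k (suc (suc m)) T) (red≡T' : red T ≡ T') where

    A : Fin (suc k) → ℕ
    A i = entry T i zero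

    module A = StrictlyIncreasing toℕ toℕ-injective (λ {i} {i'} → IsT.colInc t i i' zero)

    q : Fin (suc k) → ℕ
    q i = redRank T (A i)

    E'≡redRank : ∀ i j → E' i j ≡ redRank T (entry T i (suc j))
    E'≡redRank i j = trans (cong (λ U → entry U i j) (sym red≡T')) (entry-red T i j)

    entry≡count+redRank : ∀ i j → entry T i j ≡ count (_≤? entry T i j) (tabulate A) + redRank T (entry T i j)
    entry≡count+redRank i j = trans (sym (count≤-entries t (entry T i j) (proj₂ (IsT.inRange t i j))))
                                    (count-entries-split (_≤? entry T i j) T)

    A≡1+[q+i] : ∀ i → A i ≡ suc (q i + toℕ i)
    A≡1+[q+i] i = begin
      A i                                       ≡⟨ entry≡count+redRank i zero ⟩
      count (_≤? A i) (tabulate A) + q i        ≡⟨ cong (_+ q i) (count-tabulate-cong (_≤? A i) (_<? suc (toℕ i)) A (toℕ {suc k})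
                                                     (λ _ → mk⇔ (s≤s ∘ A.reflects-≤) (A.monotone ∘ s≤s⁻¹))) ⟩
      countBelow (toℕ {suc k}) (suc (toℕ i)) + q i ≡⟨ cong (_+ q i) (countBelow-toℕ {suc k} (suc (toℕ i)) (toℕ<n i)) ⟩
      suc (toℕ i + q i)                         ≡⟨ cong suc (+-comm (toℕ i) (q i)) ⟩
      suc (q i + toℕ i)                         ∎
      where open ≡-Reasoning

    entry≢A : ∀ i j i' → entry T i (suc j) ≢ A i'
    entry≢A i j i' eq = Fin-0≢1+n (sym (proj₂ (IsT.injective t i (suc j) i' zero eq)))

    entry<A⇔ : ∀ {i j i'} → entry T i (suc j) < A i' ⇔ E' i j ≤ q i'
    entry<A⇔ {i} {j} {i'} = mk⇔ to from
      where
      to : entry T i (suc j) < A i' → E' i j ≤ q i'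
      to lt = subst (_≤ q i') (sym (E'≡redRank i j))
                (count-mono (_≤? entry T i (suc j)) (_≤? A i') (λ x≤ → ≤-trans x≤ (<⇒≤ lt)) (entries (Vec.map dropFirst T)))
      from : E' i j ≤ q i' → entry T i (suc j) < A i'
      from E'≤q = ≰⇒> (λ A≤entry → <⇒≱ (subst (q i' <_) (sym (E'≡redRank i j))
                    (count-mono-< (_≤? A i') (_≤? entry T i (suc j)) (λ x≤A → ≤-trans x≤A A≤entry) entry∈
                       (λ entry≤A → entry≢A i j i' (≤-antisym entry≤A A≤entry)) ≤-refl)) E'≤q)
        where
        entry∈ = subst (_∈ entries (Vec.map dropFirst T)) (lookup-map-dropFirst T i j) (∈-entries (Vec.map dropFirst T) i j)

    A<entry⇔ : ∀ {i j i'} → A i' < entry T i (suc j) ⇔ q i' < E' i j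
    A<entry⇔ {i} {j} {i'} = mk⇔
      (λ A<entry → ≰⇒> (λ E'≤q → <-asym A<entry (Equivalence.from entry<A⇔ E'≤q)))
      (λ q<E' → ≤∧≢⇒< (≮⇒≥ (λ entry<A → <⇒≱ q<E' (Equivalence.to entry<A⇔ entry<A))) (entry≢A i j i' ∘ sym))

    q-mono : Monotonic₁ Fin._≤_ _≤_ q
    q-mono i≤i' = count-mono (_≤? _) (_≤? _) (λ x≤ → ≤-trans x≤ (A.monotone i≤i')) (entries (Vec.map dropFirst T))

    q-last<b₁' : q (fromℕ k) < b₁'
    q-last<b₁' = subst (q (fromℕ k) <_) (sym b₁'≡E')
                   (Equivalence.to A<entry⇔ (IsT.rowInc t (fromℕ k) zero (suc zero) (s≤s z≤n)))

    q<b₁' : ∀ i → q i < b₁'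
    q<b₁' i = ≤-<-trans (q-mono (≤fromℕ i)) q-last<b₁'

    rankAbove≤q : ∀ (i : Fin k) → rankAbove (q (suc i)) ≤ q (inject₁ i)
    rankAbove≤q i with rankAbove-attained (q (suc i))
    ... | inj₁ ≡0 = subst (_≤ q (inject₁ i)) (sym ≡0) z≤n
    ... | inj₂ (i₀ , s , ≡E' , E'≤q) = subst (_≤ q (inject₁ i)) (sym ≡E') (≮⇒≥ (λ q<E' →
          IsT.avoids t i zero (inject₁ i₀) (suc i₀) (suc s) (Equivalence.from A<entry⇔ q<E')
                     (IsT.colInc t (inject₁ i₀) (suc i₀) (suc s) (inject₁<suc i₀)) (Equivalence.from entry<A⇔ E'≤q)))

    -- A positive q is the value of some E' r s; avoidance in T forces E' (r + 1) s ≤ q (i + 1).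
    q≤rankAbove : ∀ (i : Fin k) → q (inject₁ i) ≤ rankAbove (q (suc i))
    q≤rankAbove i with m≤n⇒m<n∨m≡n (z≤n {q (inject₁ i)})
    ... | inj₂ 0≡q = subst (_≤ rankAbove (q (suc i))) 0≡q z≤n
    ... | inj₁ 0<q with IsT.covers t' (q (inject₁ i)) 0<q (<⇒≤ (<-≤-trans (q<b₁' (inject₁ i)) b₁'≤N'))
    ...   | r₁ , s , E'≡q with <⇒inject₁ (A.reflects-< {r₁} {inject₁ i}
                                 (<-trans (IsT.rowInc t r₁ zero (suc s) (s≤s z≤n)) (Equivalence.from entry<A⇔ (≤-reflexive E'≡q))))
    ...     | r₀ , refl = subst (_≤ rankAbove (q (suc i))) E'≡q (≤-rankAbove r₀ s E'-below)
      where
      E'-below : E' (suc r₀) s ≤ q (suc i)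
      E'-below with entry T (suc r₀) (suc s) <? A (suc i)
      ... | yes entry<A = Equivalence.to entry<A⇔ entry<A
      ... | no entry≮A  = ⊥-elim (IsT.avoids t r₀ (suc s) (inject₁ i) (suc i) zero
                            (Equivalence.from entry<A⇔ (≤-reflexive E'≡q)) (IsT.colInc t (inject₁ i) (suc i) zero (inject₁<suc i))
                            (≤∧≢⇒< (≮⇒≥ entry≮A) (entry≢A (suc r₀) s (suc i) ∘ sym)))

    open Construction (q (fromℕ k))

    q≡rank : ∀ i → q i ≡ rank i
    q≡rank = >-weakInduction (λ i → q i ≡ rank i) (sym rank-last) λ i q≡ → begin
      q (inject₁ i)             ≡⟨ ≤-antisym (q≤rankAbove i) (rankAbove≤q i) ⟩
      rankAbove (q (suc i))     ≡⟨ cong rankAbove q≡ ⟩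
      rankAbove (rank (suc i))  ≡⟨ rank-step i ⟨
      rank (inject₁ i)          ∎
      where open ≡-Reasoning

    entry≡extendedEntry : ∀ i j → entry T i j ≡ extendedEntry i j
    entry≡extendedEntry i zero    = trans (A≡1+[q+i] i) (cong (λ x → suc (x + toℕ i)) (q≡rank i))
    entry≡extendedEntry i (suc j) = begin
      entry T i (suc j)                                                       ≡⟨ entry≡count+redRank i (suc j) ⟩
      count (_≤? entry T i (suc j)) (tabulate A) + redRank T (entry T i (suc j)) ≡⟨ cong₂ _+_ count≡ (sym (E'≡redRank i j)) ⟩
      countBelow rank (E' i j) + E' i j                                       ≡⟨ +-comm _ (E' i j) ⟩
      shift (E' i j)                                                          ∎
      where
      open ≡-Reasoning
      count≡ = count-tabulate-cong (_≤? entry T i (suc j)) (_<? E' i j) A rank λ i' → mk⇔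
        (λ A≤entry → subst (_< E' i j) (q≡rank i') (Equivalence.to A<entry⇔ (≤∧≢⇒< A≤entry (entry≢A i j i' ∘ sym))))
        (λ rank<E' → <⇒≤ (Equivalence.from A<entry⇔ (subst (_< E' i j) (sym (q≡rank i')) rank<E')))

    T≡extend : T ≡ extend (q (fromℕ k))
    T≡extend = Array-ext λ i j → trans (entry≡extendedEntry i j) (sym (entry-extended i j))

  reconstruction : ∀ {T} → IsExtension T → Σ ℕ λ P → P < b₁' × T ≡ extend P
  reconstruction (t , red≡T') = q (fromℕ k) , q-last<b₁' , T≡extend
    where open Reconstruction t red≡T'

  extend-isExtension : ∀ {P} → P < b₁' → IsExtension (extend P)
  extend-isExtension {P} P<b₁' = Construction.extended-isT P P<b₁' , Construction.red-extended P

  head-last-extend : ∀ P → head (last (extend P)) ≡ suc (P + k)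
  head-last-extend = Construction.head-last-extended

  extend-injective : ∀ {P P'} → head (last (extend P)) ≡ head (last (extend P')) → P ≡ P'
  extend-injective {P} {P'} eq = +-cancelʳ-≡ k P P' (suc-injective (trans (sym (head-last-extend P)) (trans eq (head-last-extend P'))))

  extensions : Σ (List (Array k (suc (suc m)))) λ Ts → Unique Ts × length Ts ≡ b₁' × (∀ T → T ∈ Ts ⇔ IsExtension T)
  extensions = tabulate (extend ∘ toℕ) , Unique.tabulate⁺ (toℕ-injective ∘ extend-injective ∘ cong (head ∘ last)) ,
               length-tabulate (extend ∘ toℕ) , λ T → mk⇔ (listed⇒extension T) (extension⇒listed T)
    where
    listed⇒extension : ∀ T → T ∈ tabulate (extend ∘ toℕ) → IsExtension T
    listed⇒extension T T∈ = let x , T≡ = ∈-tabulate⁻ T∈ in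
      subst IsExtension (sym T≡) (extend-isExtension (toℕ<n x))
    extension⇒listed : ∀ T → IsExtension T → T ∈ tabulate (extend ∘ toℕ)
    extension⇒listed T ext = let P , P<b₁' , T≡ = reconstruction ext in
      subst (_∈ tabulate (extend ∘ toℕ)) (sym (trans T≡ (cong extend (sym (toℕ-fromℕ< P<b₁')))))
            (∈-tabulate⁺ (fromℕ< P<b₁'))

  bottom-row : ∀ {T} → IsExtension T →
               (∀ j → lookup (last T) (suc j) ≡ lookup (last T') j + suc k) × (suc k ≤ head (last T) × head (last T) ≤ k + b₁')
  bottom-row ext with reconstruction ext
  ... | P , P<b₁' , refl = Construction.bottom-row-extended P P<b₁' ,
                           subst (λ h → suc k ≤ h × h ≤ k + b₁') (sym (head-last-extend P)) (suc[n+k]-range k P<b₁')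

  extension-with-corner : ∀ c → suc k ≤ c → c ≤ k + b₁' →
                          Σ (Array k (suc (suc m))) λ T → (IsExtension T × head (last T) ≡ c) ×
                            (∀ T₂ → IsExtension T₂ → head (last T₂) ≡ c → T₂ ≡ T)
  extension-with-corner c 1+k≤c c≤k+b₁' = extend P , (extend-isExtension P<b₁' , trans (head-last-extend P) 1+[P+k]≡c) , unique
    where
    P = c ∸ suc k
    P<b₁' = proj₁ (suc[n+k]-range⁻¹ k 1+k≤c c≤k+b₁')
    1+[P+k]≡c = proj₂ (suc[n+k]-range⁻¹ k 1+k≤c c≤k+b₁')
    unique : ∀ T₂ → IsExtension T₂ → head (last T₂) ≡ c → T₂ ≡ extend P
    unique T₂ ext₂ head≡c = let P₂ , _ , T₂≡ = reconstruction ext₂ in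
      trans T₂≡ (cong extend (extend-injective (begin
        head (last (extend P₂)) ≡⟨ cong (head ∘ last) T₂≡ ⟨
        head (last T₂)          ≡⟨ head≡c ⟩
        c                       ≡⟨ 1+[P+k]≡c ⟨
        suc (P + k)             ≡⟨ head-last-extend P ⟨
        head (last (extend P))  ∎)))
      where open ≡-Reasoning

theorem4p4 : (k m : ℕ) → 1 ≤ k → (T' : Array k (suc m)) → IsT k (suc m) T' →
    (Σ (List (Array k (suc (suc m)))) (λ Ts →
        Unique Ts × length Ts ≡ head (last T')
        × ((T : Array k (suc (suc m))) → (T ∈ Ts) ⇔ (IsT k (suc (suc m)) T × red T ≡ T'))))
    × ((T : Array k (suc (suc m))) → IsT k (suc (suc m)) T → red T ≡ T' →
        ((j : Fin (suc m)) → lookup (last T) (Fin.suc j) ≡ lookup (last T') j + suc k)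
        × (suc k ≤ head (last T) × head (last T) ≤ k + head (last T')))
    × ((c : ℕ) → suc k ≤ c → c ≤ k + head (last T') →
        Σ (Array k (suc (suc m))) (λ T →
          (IsT k (suc (suc m)) T × red T ≡ T' × head (last T) ≡ c)
          × ((T₂ : Array k (suc (suc m))) →
               IsT k (suc (suc m)) T₂ → red T₂ ≡ T' → head (last T₂) ≡ c → T₂ ≡ T)))
theorem4p4 k m _ T' t' =
  extensions ,
  (λ T t red≡T' → bottom-row (t , red≡T')) ,
  (λ c 1+k≤c c≤k+b₁' → let T , ((t , red≡T') , corner) , unique = extension-with-corner c 1+k≤c c≤k+b₁'
                      in T , (t , red≡T' , corner) , λ T₂ t₂ red₂ → unique T₂ (t₂ , red₂))
  where open Extensions k m T' t'
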